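{- Let $t$ be a positive integer that is not a power of two. Then the number of odd integers among $\mathfrak{a}_t(t,0),\mathfrak{a}_t(t,1),\dots,\mathfrak{a}_t(t,t)$ is an odd number greater than one (and hence not a power of two).
   Context: For a positive integer $t$, $\mathfrak{a}_t:\mathbb{Z}\times\mathbb{Z}\to\mathbb{Z}$ is the unique function satisfying: $\mathfrak{a}_t(0,0)=1$; $\mathfrak{a}_t(n,k)=0$ if $n<0$, or $k<0$, or $k>\min\{\lfloor (n-1+t)/2\rfloor, n\}$; and $\mathfrak{a}_t(n,k)=\mathfrak{a}_t(n-1,k-1)+\mathfrak{a}_t(n-1,k)$ for all other integer pairs $(n,k)\neq(0,0)$. -}

module Defs where

open import Data.Nat using (ℕ; zero; suc; _+_; _≤?_; _⊓_; _/_; _%_)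
open import Data.List using (List; length; filter; upTo)
open import Relation.Nullary using (does; yes; no)
open import Data.Nat using (_≟_)

-- 𝔞_t(n,k) for n, k ≥ 0 (it vanishes whenever n < 0 or k < 0).
-- Boundary: k > min(⌊(n-1+t)/2⌋, n) gives 0; for n ≥ 1 and k in range,
-- 𝔞_t(n,k) = 𝔞_t(n-1,k-1) + 𝔞_t(n-1,k), with 𝔞_t(n-1,-1) = 0.
-- Values are nonnegative, so ℕ-valued.
𝔞 : ℕ → ℕ → ℕ → ℕ
𝔞 t zero zero = 1
𝔞 t zero (suc k) = 0
𝔞 t (suc n) k with k ≤? ((n + t) / 2) ⊓ suc n
𝔞 t (suc n) zero    | yes _ = 𝔞 t n zero
𝔞 t (suc n) (suc k) | yes _ = 𝔞 t n k + 𝔞 t n (suc k)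
... | no _ = 0

oddCount : ℕ → ℕ
oddCount t = length (filter (λ k → 𝔞 t t k % 2 ≟ 1) (upTo (suc t)))

module Submission where

-- The recurrence defining 𝔞_t is Pascal's rule, truncated at column
-- ⌊(n-1+t)/2⌋ in row n.  For every row n < t this bound is ≥ n, so no
-- truncation happens and 𝔞_t(n,k) = C(n,k).  In row t the bound is t-1:
-- the entries k < t still obey Pascal's rule and hence agree with C(t,k)
-- modulo 2, while 𝔞_t(t,t) = 0 even though C(t,t) = 1.  Therefore
--   oddCount t + 1 = number of odd entries in row t of Pascal's triangle.
-- By Lucas' theorem for p = 2 (proved here one binary digit at a time)
-- that number c(n) satisfies c(2m) = c(m) and c(2m+1) = 2·c(m), and by
-- strong induction c(n) = 2 for powers of two n while c(n) is an even
-- number ≥ 4 for every other positive n.  Hence, for t not a power of two,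
-- oddCount t = c(t) - 1 is odd and larger than one.

open import Defs
open import Data.Nat using (ℕ; _^_; _<_; _%_)
open import Data.Product using (∃; _×_)
open import Relation.Binary.PropositionalEquality using (_≡_)
open import Relation.Nullary using (¬_)

open import Data.Nat
  using (zero; suc; _+_; _*_; _≤_; z≤n; s≤s; _≤?_; _⊓_; _/_; _≟_; parity)
open import Data.Nat.Properties
open import Data.Nat.DivMod using (m*n/n≡m; /-monoˡ-≤; m<n*o⇒m/o<n)
open import Data.Nat.Induction using (<-rec)
open import Data.Parity.Base using (Parity; 0ℙ; 1ℙ) renaming (_+_ to _⊕_)
import Data.Parity.Properties as ℙ
open import Algebra.Properties.CommutativeSemigroup +-commutativeSemigroup
  using (interchange)
open import Data.Bool using (Bool; true; false; if_then_else_)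
open import Data.List using ([_]; _++_; length; filter; upTo)
open import Data.List.Properties using (upTo-∷ʳ; filter-++; length-++)
open import Data.Product using (_,_; proj₁; proj₂)
open import Data.Sum using (_⊎_; inj₁; inj₂)
open import Function using (_∘_)
open import Relation.Nullary using (does; yes; no; contradiction)
open import Relation.Unary using (Pred; Decidable)
open import Relation.Binary.PropositionalEquality
  using (refl; sym; trans; cong; cong₂; subst; module ≡-Reasoning)

-- Doubling by structural recursion, so that 2m and 2m+1 can be matched on.
double : ℕ → ℕ
double zero    = zero
double (suc n) = suc (suc (double n))

double≡+ : ∀ n → double n ≡ n + n
double≡+ zero    = refl
double≡+ (suc n) = cong suc (trans (cong suc (double≡+ n)) (sym (+-suc n n)))

n≤double : ∀ n → n ≤ double n
n≤double zero    = z≤n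
n≤double (suc n) = s≤s (m≤n⇒m≤1+n (n≤double n))

double-2^ : ∀ k → double (2 ^ k) ≡ 2 ^ suc k
double-2^ k = trans (double≡+ (2 ^ k)) (cong (2 ^ k +_) (sym (+-identityʳ (2 ^ k))))

data Half : ℕ → Set where
  even : ∀ m → Half (double m)
  odd  : ∀ m → Half (suc (double m))

half : ∀ n → Half n
half zero = even zero
half (suc n) with half n
... | even m = odd m
... | odd m  = even (suc m)

pascal₂ : ℕ → ℕ → Parity
pascal₂ zero    zero    = 1ℙ
pascal₂ zero    (suc k) = 0ℙ
pascal₂ (suc n) zero    = 1ℙ
pascal₂ (suc n) (suc k) = pascal₂ n k ⊕ pascal₂ n (suc k)

pascal₂-first : ∀ n → pascal₂ n 0 ≡ 1ℙ
pascal₂-first zero    = refl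
pascal₂-first (suc n) = refl

pascal₂-above : ∀ n k → n < k → pascal₂ n k ≡ 0ℙ
pascal₂-above zero    (suc k) _         = refl
pascal₂-above (suc n) (suc k) (s≤s n<k) =
  cong₂ _⊕_ (pascal₂-above n k n<k) (pascal₂-above n (suc k) (m<n⇒m<1+n n<k))

pascal₂-diagonal : ∀ n → pascal₂ n n ≡ 1ℙ
pascal₂-diagonal zero    = refl
pascal₂-diagonal (suc n) =
  cong₂ _⊕_ (pascal₂-diagonal n) (pascal₂-above n (suc n) (n<1+n n))

⊕-self : ∀ p → p ⊕ p ≡ 0ℙ
⊕-self = proj₁ ℙ.+-inverse

⊕-identityʳ : ∀ p → p ⊕ 0ℙ ≡ p
⊕-identityʳ = proj₂ ℙ.+-identity

-- C(2m+a, 2j+b) ≡ C(m,j)·C(a,b) (mod 2) for digits a, b.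
mutual
  pascal₂-even-even : ∀ m j → pascal₂ (double m) (double j) ≡ pascal₂ m j
  pascal₂-even-even zero    zero    = refl
  pascal₂-even-even zero    (suc j) = refl
  pascal₂-even-even (suc m) zero    = refl
  pascal₂-even-even (suc m) (suc j) =
    cong₂ _⊕_ (pascal₂-odd-odd m j) (pascal₂-odd-even m (suc j))

  pascal₂-even-odd : ∀ m j → pascal₂ (double m) (suc (double j)) ≡ 0ℙ
  pascal₂-even-odd zero    j = refl
  pascal₂-even-odd (suc m) j =
    trans (cong₂ _⊕_ (pascal₂-odd-even m j) (pascal₂-odd-odd m j)) (⊕-self (pascal₂ m j))

  pascal₂-odd-even : ∀ m j → pascal₂ (suc (double m)) (double j) ≡ pascal₂ m j
  pascal₂-odd-even m zero    = sym (pascal₂-first m)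
  pascal₂-odd-even m (suc j) =
    cong₂ _⊕_ (pascal₂-even-odd m j) (pascal₂-even-even m (suc j))

  pascal₂-odd-odd : ∀ m j → pascal₂ (suc (double m)) (suc (double j)) ≡ pascal₂ m j
  pascal₂-odd-odd m j =
    trans (cong₂ _⊕_ (pascal₂-even-even m j) (pascal₂-even-odd m j)) (⊕-identityʳ (pascal₂ m j))

indicator : Bool → ℕ
indicator b = if b then 1 else 0

count : (ℕ → Bool) → ℕ → ℕ
count f zero    = 0
count f (suc n) = count f n + indicator (f n)

count-ext : ∀ n {f g : ℕ → Bool} → (∀ k → k < n → f k ≡ g k) → count f n ≡ count g n
count-ext zero    f≗g = refl
count-ext (suc n) f≗g =
  cong₂ _+_ (count-ext n (λ k k<n → f≗g k (m<n⇒m<1+n k<n))) (cong indicator (f≗g n (n<1+n n)))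

count-none : ∀ n → count (λ _ → false) n ≡ 0
count-none zero    = refl
count-none (suc n) = trans (+-identityʳ (count (λ _ → false) n)) (count-none n)

count-double : ∀ (f : ℕ → Bool) m →
  count f (double m) ≡ count (f ∘ double) m + count (f ∘ suc ∘ double) m
count-double f zero    = refl
count-double f (suc m) = begin
  count f (double m) + a + b                                 ≡⟨ +-assoc (count f (double m)) a b ⟩
  count f (double m) + (a + b)                               ≡⟨ cong (_+ (a + b)) (count-double f m) ⟩
  count (f ∘ double) m + count (f ∘ suc ∘ double) m + (a + b) ≡⟨ interchange (count (f ∘ double) m) (count (f ∘ suc ∘ double) m) a b ⟩
  count (f ∘ double) m + a + (count (f ∘ suc ∘ double) m + b) ∎
  where
    open ≡-Reasoning
    a = indicator (f (double m))
    b = indicator (f (suc (double m)))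

length-filter-upTo : ∀ {p} {Q : Pred ℕ p} (Q? : Decidable Q) n →
  length (filter Q? (upTo n)) ≡ count (does ∘ Q?) n
length-filter-upTo Q? zero    = refl
length-filter-upTo Q? (suc n) = begin
  length (filter Q? (upTo (suc n)))                         ≡⟨ cong (length ∘ filter Q?) (sym (upTo-∷ʳ n)) ⟩
  length (filter Q? (upTo n ++ [ n ]))                      ≡⟨ cong length (filter-++ Q? (upTo n) [ n ]) ⟩
  length (filter Q? (upTo n) ++ filter Q? [ n ])            ≡⟨ length-++ (filter Q? (upTo n)) ⟩
  length (filter Q? (upTo n)) + length (filter Q? [ n ])    ≡⟨ cong₂ _+_ (length-filter-upTo Q? n) (singleton n) ⟩
  count (does ∘ Q?) n + indicator (does (Q? n))             ∎
  where
    open ≡-Reasoning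
    singleton : ∀ x → length (filter Q? [ x ]) ≡ indicator (does (Q? x))
    singleton x with does (Q? x)
    ... | true  = refl
    ... | false = refl

isOdd : Parity → Bool
isOdd 0ℙ = false
isOdd 1ℙ = true

oddIn : ℕ → ℕ → Bool
oddIn n = isOdd ∘ pascal₂ n

rowOdd : ℕ → ℕ
rowOdd n = count (oddIn n) (suc n)

rowOdd-extend : ∀ n M → n < M → count (oddIn n) M ≡ rowOdd n
rowOdd-extend n (suc M) (s≤s n≤M) with m≤n⇒m<n∨m≡n n≤M
... | inj₂ refl = refl
... | inj₁ n<M  = begin
  count (oddIn n) M + indicator (oddIn n M) ≡⟨ cong (λ p → count (oddIn n) M + indicator (isOdd p)) (pascal₂-above n M n<M) ⟩
  count (oddIn n) M + 0                     ≡⟨ +-identityʳ (count (oddIn n) M) ⟩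
  count (oddIn n) M                         ≡⟨ rowOdd-extend n M n<M ⟩
  rowOdd n                                  ∎
  where open ≡-Reasoning

-- c(2m) = c(m): only the even columns of row 2m are odd.
rowOdd-even : ∀ m → rowOdd (double m) ≡ rowOdd m
rowOdd-even m = begin
  rowOdd (double m)                                    ≡⟨ sym (rowOdd-extend (double m) (double (suc m)) (m<n⇒m<1+n (n<1+n (double m)))) ⟩
  count (oddIn (double m)) (double (suc m))            ≡⟨ count-double (oddIn (double m)) (suc m) ⟩
  count (oddIn (double m) ∘ double) (suc m)
    + count (oddIn (double m) ∘ suc ∘ double) (suc m)  ≡⟨ cong₂ _+_ (count-ext (suc m) (λ j _ → cong isOdd (pascal₂-even-even m j)))
                                                                   (count-ext (suc m) (λ j _ → cong isOdd (pascal₂-even-odd m j))) ⟩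
  rowOdd m + count (λ _ → false) (suc m)               ≡⟨ cong (rowOdd m +_) (count-none (suc m)) ⟩
  rowOdd m + 0                                         ≡⟨ +-identityʳ (rowOdd m) ⟩
  rowOdd m                                             ∎
  where open ≡-Reasoning

-- c(2m+1) = 2·c(m): row 2m+1 contains row m twice, interleaved.
rowOdd-odd : ∀ m → rowOdd (suc (double m)) ≡ double (rowOdd m)
rowOdd-odd m = begin
  rowOdd (suc (double m))                                  ≡⟨ count-double (oddIn (suc (double m))) (suc m) ⟩
  count (oddIn (suc (double m)) ∘ double) (suc m)
    + count (oddIn (suc (double m)) ∘ suc ∘ double) (suc m) ≡⟨ cong₂ _+_ (count-ext (suc m) (λ j _ → cong isOdd (pascal₂-odd-even m j)))
                                                                       (count-ext (suc m) (λ j _ → cong isOdd (pascal₂-odd-odd m j))) ⟩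
  rowOdd m + rowOdd m                                      ≡⟨ sym (double≡+ (rowOdd m)) ⟩
  double (rowOdd m)                                        ∎
  where open ≡-Reasoning

RowShape : ℕ → Set
RowShape n = (∃ λ k → n ≡ 2 ^ k × rowOdd n ≡ 2) ⊎ (∃ λ x → rowOdd n ≡ double (2 + x))

rowShape : ∀ n → 0 < n → RowShape n
rowShape = <-rec (λ n → 0 < n → RowShape n) step
  where
    step : ∀ n → (∀ {m} → m < n → 0 < m → RowShape m) → 0 < n → RowShape n
    step n ih pos with half n
    step _ ih () | even zero
    step _ ih _  | even (suc m) with ih (s≤s (s≤s (n≤double m))) (s≤s z≤n)
    ... | inj₁ (k , m≡2^k , c≡2) =
      inj₁ (suc k , trans (cong double m≡2^k) (double-2^ k) , trans (rowOdd-even (suc m)) c≡2)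
    ... | inj₂ (x , c≡) = inj₂ (x , trans (rowOdd-even (suc m)) c≡)
    step _ ih _  | odd zero = inj₁ (0 , refl , refl)
    step _ ih _  | odd (suc m) with ih (s≤s (n≤double (suc m))) (s≤s z≤n)
    ... | inj₁ (_ , _ , c≡2) = inj₂ (0 , trans (rowOdd-odd (suc m)) (cong double c≡2))
    ... | inj₂ (x , c≡) = inj₂ (2 + double x , trans (rowOdd-odd (suc m)) (cong double c≡))

-- Row suc n of 𝔞_t is supported on the columns k ≤ cap t n.
cap : ℕ → ℕ → ℕ
cap t n = ((n + t) / 2) ⊓ suc n

*2≡+ : ∀ q → q * 2 ≡ q + q
*2≡+ q = trans (*-comm q 2) (cong (q +_) (+-identityʳ q))

/2-lower : ∀ {q m} → q * 2 ≤ m → q ≤ m / 2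
/2-lower {q} q*2≤m = subst (_≤ _) (m*n/n≡m q 2) (/-monoˡ-≤ 2 q*2≤m)

/2-upper : ∀ {q m} → m < suc q * 2 → m / 2 ≤ q
/2-upper m<2q+2 = ≤-pred (m<n*o⇒m/o<n m<2q+2)

cap-full : ∀ t n → 2 + n ≤ t → cap t n ≡ suc n
cap-full t n 2+n≤t = m≥n⇒m⊓n≡n (/2-lower (begin
  suc n * 2            ≡⟨ *2≡+ (suc n) ⟩
  suc n + suc n        ≡⟨ sym (+-suc n (suc n)) ⟩
  n + suc (suc n)      ≤⟨ +-monoʳ-≤ n 2+n≤t ⟩
  n + t                ∎))
  where open ≤-Reasoning

cap-top : ∀ u → cap (suc u) u ≡ u
cap-top u = trans (cong (_⊓ suc u) half≡u) (m≤n⇒m⊓n≡m (n≤1+n u))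
  where
    lower : u * 2 ≤ u + suc u
    lower = subst (_≤ u + suc u) (sym (*2≡+ u)) (+-monoʳ-≤ u (n≤1+n u))
    upper : u + suc u < suc u * 2
    upper = ≤-reflexive (sym (*2≡+ (suc u)))
    half≡u : (u + suc u) / 2 ≡ u
    half≡u = ≤-antisym (/2-upper upper) (/2-lower lower)

𝔞-outside : ∀ t n k → ¬ (k ≤ cap t n) → 𝔞 t (suc n) k ≡ 0
𝔞-outside t n k k≰cap with k ≤? cap t n
𝔞-outside t n k       k≰cap | yes k≤cap = contradiction k≤cap k≰cap
𝔞-outside t n zero    k≰cap | no _      = refl
𝔞-outside t n (suc k) k≰cap | no _      = refl

𝔞-inside : ∀ t n k → k ≤ cap t n → (∀ j → parity (𝔞 t n j) ≡ pascal₂ n j) →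
  parity (𝔞 t (suc n) k) ≡ pascal₂ (suc n) k
𝔞-inside t n k k≤cap prev with k ≤? cap t n
𝔞-inside t n k       k≤cap prev | no k≰cap = contradiction k≤cap k≰cap
𝔞-inside t n zero    k≤cap prev | yes _    = trans (prev 0) (pascal₂-first n)
𝔞-inside t n (suc k) k≤cap prev | yes _    =
  trans (ℙ.+-homo-+ (𝔞 t n k) (𝔞 t n (suc k))) (cong₂ _⊕_ (prev k) (prev (suc k)))

𝔞-below-top : ∀ t n → n < t → ∀ k → parity (𝔞 t n k) ≡ pascal₂ n k
𝔞-below-top t zero    n<t zero    = refl
𝔞-below-top t zero    n<t (suc k) = refl
𝔞-below-top t (suc n) n<t k with k ≤? suc n
... | yes k≤n = 𝔞-inside t n k (subst (k ≤_) (sym (cap-full t n n<t)) k≤n) (𝔞-below-top t n (<⇒≤ n<t))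
... | no  k≰n = begin
  parity (𝔞 t (suc n) k) ≡⟨ cong parity (𝔞-outside t n k (k≰n ∘ subst (k ≤_) (cap-full t n n<t))) ⟩
  0ℙ                     ≡⟨ sym (pascal₂-above (suc n) k (≰⇒> k≰n)) ⟩
  pascal₂ (suc n) k      ∎
  where open ≡-Reasoning

𝔞-top-row : ∀ u k → k ≤ u → parity (𝔞 (suc u) (suc u) k) ≡ pascal₂ (suc u) k
𝔞-top-row u k k≤u =
  𝔞-inside (suc u) u k (subst (k ≤_) (sym (cap-top u)) k≤u) (𝔞-below-top (suc u) u (n<1+n u))

𝔞-top-corner : ∀ u → 𝔞 (suc u) (suc u) (suc u) ≡ 0
𝔞-top-corner u = 𝔞-outside (suc u) u (suc u) (1+n≰n ∘ subst (suc u ≤_) (cap-top u))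

isOdd-parity : ∀ m → does (m % 2 ≟ 1) ≡ isOdd (parity m)
isOdd-parity zero          = refl
isOdd-parity (suc zero)    = refl
isOdd-parity (suc (suc m)) = isOdd-parity m

oddCount-rowOdd : ∀ u → suc (oddCount (suc u)) ≡ rowOdd (suc u)
oddCount-rowOdd u = begin
  suc (oddCount t)                      ≡⟨ cong suc (length-filter-upTo (λ k → 𝔞 t t k % 2 ≟ 1) (suc t)) ⟩
  suc (count odd𝔞 t + indicator (odd𝔞 t)) ≡⟨ cong (λ b → suc (count odd𝔞 t + indicator b)) corner ⟩
  suc (count odd𝔞 t + 0)                ≡⟨ cong suc (+-identityʳ (count odd𝔞 t)) ⟩
  suc (count odd𝔞 t)                    ≡⟨ cong suc (count-ext t agree) ⟩
  suc (count (oddIn t) t)               ≡⟨ +-comm 1 (count (oddIn t) t) ⟩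
  count (oddIn t) t + 1                 ≡⟨ cong (λ p → count (oddIn t) t + indicator (isOdd p)) (sym (pascal₂-diagonal t)) ⟩
  rowOdd t                              ∎
  where
    open ≡-Reasoning
    t : ℕ
    t = suc u
    odd𝔞 : ℕ → Bool
    odd𝔞 k = does (𝔞 t t k % 2 ≟ 1)
    corner : odd𝔞 t ≡ false
    corner = trans (isOdd-parity (𝔞 t t t)) (cong (isOdd ∘ parity) (𝔞-top-corner u))
    agree : ∀ k → k < t → odd𝔞 k ≡ oddIn t k
    agree k k<t = trans (isOdd-parity (𝔞 t t k)) (cong isOdd (𝔞-top-row u k (≤-pred k<t)))

odd-%2 : ∀ y → suc (double y) % 2 ≡ 1
odd-%2 zero    = refl
odd-%2 (suc y) = odd-%2 y

lemma4p4 : (t : ℕ) → 0 < t → ¬ (∃ λ m → t ≡ 2 ^ m) →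
    (oddCount t % 2 ≡ 1) × (1 < oddCount t)
lemma4p4 zero    ()
lemma4p4 (suc u) _ notPower with rowShape (suc u) (s≤s z≤n)
... | inj₁ (k , t≡2^k , _) = contradiction (k , t≡2^k) notPower
... | inj₂ (x , c≡2[2+x]) =
  subst (λ o → (o % 2 ≡ 1) × (1 < o)) (sym oddCount≡) (odd-%2 (suc x) , s≤s (s≤s z≤n))
  where
    oddCount≡ : oddCount (suc u) ≡ suc (double (suc x))
    oddCount≡ = suc-injective (trans (oddCount-rowOdd u) c≡2[2+x])
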